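{- Let $S_1,S_2,T$ be predicate-free schemas and $v,w\in\mathcal V$ such that $M[S_1]_e(v)\ne M[S_2]_e(v)$ and $M[T]_e(w)$ is a $vG$-term for some $G\in\mathcal F^*$. Then $M[S_1T]_e(w)\ne M[S_2T]_e(w)$.
   Context: Terms over function symbols $\mathcal F$ (with arities) and variables $\mathcal V$: variables and $f(t_1,\dots,t_n)$. A predicate-free schema is a finite sequence of $\mathtt{skip}$s and assignments $y:=f(\mathbf x);$; juxtaposition is concatenation. $e(v)=v$ is the natural state and $M[S]_e$ is the state (map from variables to terms) obtained from $e$ by executing the assignments of $S$ in order, $y:=f(x_1,\dots,x_n)$ setting $y$ to $f(d(x_1),\dots,d(x_n))$, $d$ the current state. $vF$-terms for $v\in\mathcal V$, $F\in\mathcal F^*$: the term $v$ is a $v$-term (empty $F$); if some $t_k$ is a $vF$-term and $g\in\mathcal F$ then $g(t_1,\dots,t_n)$ is a $vFg$-term. -}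

module Defs where

open import Data.Nat using (ℕ)
open import Data.List using (List; []; _∷_; _++_; [_])
open import Data.Vec using (Vec; map)
open import Data.Vec.Relation.Unary.Any using (Any)
open import Relation.Binary.Definitions using (DecidableEquality)
open import Relation.Nullary using (yes; no)

module _ {F : Set} (arity : F → ℕ) (V : Set) where

  data Term : Set where
    var : V → Term
    app : (f : F) → Vec Term (arity f) → Term

  data Instr : Set where
    skip   : Instr
    assign : (y : V) (f : F) → Vec V (arity f) → Instr

  -- A predicate-free schema is a finite sequence of instructions;
  -- juxtaposition is list concatenation _++_.
  Schema : Set
  Schema = List Instr

  State : Set
  State = V → Term

  e : State
  e v = var v

  data IsPathTerm (v : V) : List F → Term → Set where
    here : IsPathTerm v [] (var v)
    step : ∀ {G} (g : F) (ts : Vec Term (arity g)) →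
           Any (IsPathTerm v G) ts → IsPathTerm v (G ++ [ g ]) (app g ts)

module _ {F : Set} {arity : F → ℕ} {V : Set} (_≟_ : DecidableEquality V) where

  update : State arity V → V → Term arity V → State arity V
  update d y t x with x ≟ y
  ... | yes _ = t
  ... | no  _ = d x

  execInstr : Instr arity V → State arity V → State arity V
  execInstr skip d = d
  execInstr (assign y f xs) d = update d y (app f (map d xs))

  M[_]_ : Schema arity V → State arity V → State arity V
  M[ [] ] d = d
  M[ i ∷ S ] d = M[ S ] (execInstr i d)

module Submission where

-- Read a term t as a pattern whose variables may be replaced by
-- the values of a state d; write  d ⟪ t ⟫  for this substitution.
--   (1) Running a schema commutes with substitution: executing S from the
--       state d equals executing S symbolically from the natural state e and
--       then substituting d, i.e.  M[S]_d(x) = d ⟪ M[S]_e(x) ⟫.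
--   (2) Running S ++ T is running T from the state reached by S.
--   (3) If t is a vG-term, then d₁ ⟪ t ⟫ = d₂ ⟪ t ⟫ forces d₁(v) = d₂(v):
--       peel the path from the root of t down to its occurrence of v,
--       using injectivity of the term constructors.
-- For the theorem let dᵢ = M[Sᵢ]_e and t = M[T]_e(w).  By (2) and (1),
-- M[SᵢT]_e(w) = dᵢ ⟪ t ⟫, so equal results at w would give d₁(v) = d₂(v)
-- by (3), contradicting the hypothesis.

open import Defs
open import Data.Nat using (ℕ)
open import Data.List using (List; _++_; []; _∷_)
open import Data.Product using (∃; _,_)
open import Data.Vec using (Vec; []; _∷_; map)
open import Data.Vec.Properties using (∷-injectiveˡ; ∷-injectiveʳ)
open import Data.Vec.Relation.Unary.Any using (Any; here; there)
open import Relation.Binary.Definitions using (DecidableEquality)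
open import Relation.Binary.PropositionalEquality
  using (_≡_; _≢_; _≗_; refl; cong; trans; sym; module ≡-Reasoning)
open import Relation.Nullary using (yes; no)

module Substitution {F : Set} {arity : F → ℕ} {V : Set} where

  -- d ⟪ t ⟫ replaces every variable x of t by d x; the vector version is
  -- spelled out so that the definition is structurally recursive.
  mutual
    _⟪_⟫ : State arity V → Term arity V → Term arity V
    d ⟪ var x ⟫    = d x
    d ⟪ app f ts ⟫ = app f (d ⟪ ts ⟫*)

    _⟪_⟫* : ∀ {n} → State arity V → Vec (Term arity V) n → Vec (Term arity V) n
    d ⟪ [] ⟫*     = []
    d ⟪ t ∷ ts ⟫* = d ⟪ t ⟫ ∷ d ⟪ ts ⟫*

  ⟪map⟫* : ∀ {n} {d d′ d″ : State arity V} → d″ ≗ (λ z → d ⟪ d′ z ⟫) →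
           (xs : Vec V n) → map d″ xs ≡ d ⟪ map d′ xs ⟫*
  ⟪map⟫* h []       = refl
  ⟪map⟫* h (x ∷ xs) = trans (cong (_∷ _) (h x)) (cong (_ ∷_) (⟪map⟫* h xs))

  mutual
    path-determines : ∀ {v G t} (d₁ d₂ : State arity V) → IsPathTerm arity V v G t →
                      d₁ ⟪ t ⟫ ≡ d₂ ⟪ t ⟫ → d₁ v ≡ d₂ v
    path-determines d₁ d₂ here         eq = eq
    path-determines d₁ d₂ (step g _ p) eq =
      path-determines* d₁ d₂ p (app-injective eq)
      where
        app-injective : ∀ {us vs} → app g us ≡ app g vs → us ≡ vs
        app-injective refl = refl

    path-determines* : ∀ {v G n} {ts : Vec (Term arity V) n} (d₁ d₂ : State arity V) →
                       Any (IsPathTerm arity V v G) ts → d₁ ⟪ ts ⟫* ≡ d₂ ⟪ ts ⟫* → d₁ v ≡ d₂ v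
    path-determines* {ts = _ ∷ _} d₁ d₂ (here p)  eq = path-determines d₁ d₂ p (∷-injectiveˡ eq)
    path-determines* {ts = _ ∷ _} d₁ d₂ (there p) eq = path-determines* d₁ d₂ p (∷-injectiveʳ eq)

module Execution {F : Set} {arity : F → ℕ} {V : Set} (_≟_ : DecidableEquality V) where
  open Substitution

  execInstr-⟪⟫ : (i : Instr arity V) {d d′ d″ : State arity V} →
                 d″ ≗ (λ z → d ⟪ d′ z ⟫) →
                 execInstr _≟_ i d″ ≗ (λ z → d ⟪ execInstr _≟_ i d′ z ⟫)
  execInstr-⟪⟫ skip h x = h x
  execInstr-⟪⟫ (assign y f xs) h x with x ≟ y
  ... | yes _ = cong (app f) (⟪map⟫* h xs)
  ... | no  _ = h x

  M-⟪⟫ : (S : Schema arity V) {d d′ d″ : State arity V} →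
         d″ ≗ (λ z → d ⟪ d′ z ⟫) →
         M[_]_ _≟_ S d″ ≗ (λ z → d ⟪ M[_]_ _≟_ S d′ z ⟫)
  M-⟪⟫ []      h = h
  M-⟪⟫ (i ∷ S) h = M-⟪⟫ S (execInstr-⟪⟫ i h)

  M-from-e : (S : Schema arity V) (d : State arity V) →
             M[_]_ _≟_ S d ≗ (λ z → d ⟪ M[_]_ _≟_ S (e arity V) z ⟫)
  M-from-e S d = M-⟪⟫ S (λ _ → refl)

  M-++ : (S T : Schema arity V) (d : State arity V) →
         M[_]_ _≟_ (S ++ T) d ≗ M[_]_ _≟_ T (M[_]_ _≟_ S d)
  M-++ []      T d x = refl
  M-++ (i ∷ S) T d x = M-++ S T (execInstr _≟_ i d) x

  M-++-from-e : (S T : Schema arity V) →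
                M[_]_ _≟_ (S ++ T) (e arity V) ≗
                (λ z → M[_]_ _≟_ S (e arity V) ⟪ M[_]_ _≟_ T (e arity V) z ⟫)
  M-++-from-e S T x = trans (M-++ S T (e arity V) x) (M-from-e T (M[_]_ _≟_ S (e arity V)) x)

open Substitution using (_⟪_⟫; path-determines)
open Execution using (M-++-from-e)

proposition27 : {F : Set} (arity : F → ℕ) {V : Set} (_≟_ : DecidableEquality V)
    (S₁ S₂ T : Schema arity V) (v w : V) →
    M[_]_ _≟_ S₁ (e arity V) v ≢ M[_]_ _≟_ S₂ (e arity V) v →
    ∃ (λ (G : List F) → IsPathTerm arity V v G (M[_]_ _≟_ T (e arity V) w)) →
    M[_]_ _≟_ (S₁ ++ T) (e arity V) w ≢ M[_]_ _≟_ (S₂ ++ T) (e arity V) w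
proposition27 arity {V} _≟_ S₁ S₂ T v w d₁v≢d₂v (G , vG-term) S₁T≡S₂T =
  d₁v≢d₂v (path-determines d₁ d₂ vG-term substituted-equal)
  where
    open ≡-Reasoning
    d₁ d₂ : State arity V
    d₁ = M[_]_ _≟_ S₁ (e arity V)
    d₂ = M[_]_ _≟_ S₂ (e arity V)

    substituted-equal : d₁ ⟪ M[_]_ _≟_ T (e arity V) w ⟫ ≡ d₂ ⟪ M[_]_ _≟_ T (e arity V) w ⟫
    substituted-equal = begin
      d₁ ⟪ M[_]_ _≟_ T (e arity V) w ⟫    ≡⟨ sym (M-++-from-e _≟_ S₁ T w) ⟩
      M[_]_ _≟_ (S₁ ++ T) (e arity V) w   ≡⟨ S₁T≡S₂T ⟩
      M[_]_ _≟_ (S₂ ++ T) (e arity V) w   ≡⟨ M-++-from-e _≟_ S₂ T w ⟩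
      d₂ ⟪ M[_]_ _≟_ T (e arity V) w ⟫    ∎
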